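{- Let $s$ be a non-empty string with $r$ maximal runs. Every admissible bilateral run-peeling decomposition of $s$ uses at least $\lceil r/2 \rceil$ tokens (content tokens), and the Flashback decomposition attains this minimum: $\mathcal{F}(s)$ contains exactly $\lceil r/2 \rceil$ tokens other than the sentinel token $\tau_0 = (\texttt{@\$},1)$.
   Context: The maximal runs of a non-empty string $s$ are the blocks of its run-length encoding $s = a_1^{m_1}\cdots a_r^{m_r}$ ($m_i\ge1$, $a_i \ne a_{i+1}$). An admissible bilateral run-peeling decomposition of a non-empty string $s$ is built by repeatedly applying the following rule to an active span (initially $s$) until the span is consumed: (Termination) if the active span consists of a single run or of two adjacent runs, emit one terminal token for the span and stop; (Peeling step) otherwise let $L$ be the length of the span's leading run (longest prefix of a single repeated symbol) and $R$ the length of its trailing run (longest suffix of a single repeated symbol), choose any integers $x \in \{1,\ldots,L\}$ and $y \in \{1,\ldots,R\}$, emit one token formed by the peeled prefix of length $x$ and the peeled suffix of length $y$, and recurse on the remaining middle. The tokens emitted are called content tokens. Flashback on $s$ is the case $x = L$, $y = R$ at every step; precisely, with $\texttt{@},\texttt{\$}\notin\Sigma$ distinct and $\hat{s} = \texttt{@}\,s\,\texttt{\$}$, $\mathcal{F}(s)$ is produced starting with active span $\hat{s}$: if the span is empty, stop; if it is a single run, append (span, $0$) and stop; otherwise let $\sigma$ be the leading run followed by the trailing run, and the middle the span with both removed; if the middle is empty append $(\sigma,0)$ and stop, else append $(\sigma,\ell)$ with $\ell$ the leading run length and continue on the middle. -}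

module Defs where

open import Data.Nat using (ℕ; zero; suc; _+_; _∸_; _≤_)
open import Data.Product using (_×_; _,_)
open import Data.List using (map; List; []; _∷_; _++_; length; reverse; takeWhile; drop; take)
open import Relation.Nullary using (yes; no; ¬_)
open import Relation.Binary.PropositionalEquality using (_≡_; refl; _≢_; cong)
open import Relation.Binary.Definitions using (DecidableEquality)
open import Data.Product.Properties renaming (≡-dec to ×-≡-dec) using ()
open import Data.List.Properties renaming (≡-dec to List-≡-dec) using ()
open import Data.Nat.Properties renaming (_≟_ to ℕ-≟) using ()

module Str {B : Set} (_≟_ : DecidableEquality B) where

  rle : List B → List (B × ℕ)
  rle [] = []
  rle (x ∷ xs) with rle xs
  ... | [] = (x , 1) ∷ []
  ... | (a , m) ∷ rest with x ≟ a
  ...   | yes _ = (a , suc m) ∷ rest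
  ...   | no  _ = (x , 1) ∷ (a , m) ∷ rest

  numRuns : List B → ℕ
  numRuns s = length (rle s)

  leadRun : List B → List B
  leadRun [] = []
  leadRun (x ∷ xs) = x ∷ takeWhile (x ≟_) xs

  trailRun : List B → List B
  trailRun s = reverse (leadRun (reverse s))

  leadLen trailLen : List B → ℕ
  leadLen s = length (leadRun s)
  trailLen s = length (trailRun s)

module Decomposition {A : Set} (_≟_ : DecidableEquality A) where
  open Str _≟_

  data Decomp : List A → Set where
    term : ∀ (s : List A) → s ≢ [] → numRuns s ≤ 2 → Decomp s
    peel : ∀ (s p m q : List A) → 3 ≤ numRuns s → s ≡ p ++ m ++ q →
           1 ≤ length p → length p ≤ leadLen s →
           1 ≤ length q → length q ≤ trailLen s →
           Decomp m → Decomp s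

  tokens : ∀ {s} → Decomp s → ℕ
  tokens (term _ _ _) = 1
  tokens (peel _ _ _ _ _ _ _ _ _ _ d) = suc (tokens d)

data Ext (A : Set) : Set where
  at dollar : Ext A
  sym : A → Ext A

module Flashback {A : Set} (_≟_ : DecidableEquality A) where

  _≟ₑ_ : DecidableEquality (Ext A)
  at ≟ₑ at = yes refl
  at ≟ₑ dollar = no λ ()
  at ≟ₑ sym _ = no λ ()
  dollar ≟ₑ at = no λ ()
  dollar ≟ₑ dollar = yes refl
  dollar ≟ₑ sym _ = no λ ()
  sym _ ≟ₑ at = no λ ()
  sym _ ≟ₑ dollar = no λ ()
  sym a ≟ₑ sym b with a ≟ b
  ... | yes refl = yes refl
  ... | no a≢b = no λ { refl → a≢b refl }

  open Str _≟ₑ_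

  Token : Set
  Token = List (Ext A) × ℕ

  -- one run of Flashback on an active span; the ℕ argument is fuel,
  -- instantiated with the span length (each step shrinks the span by ≥ 2,
  -- and the span is empty exactly when the fuel is 0 along the run)
  flash : ℕ → List (Ext A) → List Token
  flash zero _ = []
  flash (suc n) [] = []
  flash (suc n) sp@(x ∷ xs) with drop (leadLen sp) sp
  ... | [] = (sp , 0) ∷ []
  ... | rest@(_ ∷ _) with take (length rest ∸ trailLen sp) rest
  ...   | [] = (leadRun sp ++ trailRun sp , 0) ∷ []
  ...   | middle@(_ ∷ _) = (leadRun sp ++ trailRun sp , leadLen sp) ∷ flash n middle

  hat : List A → List (Ext A)
  hat s = at ∷ map sym s ++ dollar ∷ []

  𝓕 : List A → List Token
  𝓕 s = flash (length (hat s)) (hat s)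

  τ₀ : Token
  τ₀ = (at ∷ dollar ∷ [] , 1)

  _≟τ_ : DecidableEquality Token
  _≟τ_ = ×-≡-dec (List-≡-dec _≟ₑ_) ℕ-≟

{-# OPTIONS --safe #-}
-- A peeled
-- prefix lies inside the leading run and a peeled suffix inside the trailing run, so each
-- carries a single run: a peeling step removes at most two runs of the span and a terminal
-- token covers at most two, whence at least ⌈r/2⌉ tokens.  Flashback peels the full leading
-- and trailing runs, so every step but the last removes exactly two runs and the last one
-- takes the remaining one or two.  On @ s $ its first step peels the sentinels and emits τ₀;
-- every later token begins with a letter of s and so differs from τ₀.
module Submission where

open import Defs
open import Data.Nat using (ℕ; zero; suc; _+_; _∸_; _⊓_; _≤_; z≤n; s≤s; ⌈_/2⌉)
open import Data.Nat.Properties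
  using ( ≤-refl; ≤-trans; ≤-reflexive; +-comm; +-assoc; +-mono-≤; +-monoˡ-≤; +-monoʳ-≤
        ; m≤n+m; >⇒≢; m⊓n≤n; m∸n≤m; m+n∸n≡m; m≤n⇒m<n∨m≡n; m≤n⇒m∸n≡0; ⌈n/2⌉-mono
        ; module ≤-Reasoning)
open import Data.Product using (_×_; ∃₂; _,_)
open import Data.Sum using (inj₁; inj₂)
open import Data.List using (List; []; _∷_; _++_; [_]; length; map; filter; reverse; takeWhile; drop; take)
open import Data.List.Properties
  using ( length-++; length-++-≤ˡ; length-reverse; length-take; length-drop; ++-assoc
        ; unfold-reverse; reverse-++; reverse-involutive; reverse-map; filter-reject; filter-all)
open import Data.List.Relation.Unary.All using (All; []; _∷_; universal)
open import Data.List.Relation.Unary.All.Properties using (take⁺; drop⁺; map⁺)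
open import Function using (_∘_)
open import Function.Definitions using (Injective)
open import Relation.Nullary using (Dec; yes; no; ¬?; contradiction)
open import Relation.Unary using (Decidable)
open import Relation.Binary.Definitions using (DecidableEquality)
open import Relation.Binary.PropositionalEquality
  using (_≡_; refl; _≢_; trans; cong; cong₂; subst; subst₂; module ≡-Reasoning)
import Relation.Binary.PropositionalEquality as ≡

all-prefix-takeWhile : ∀ {B : Set} {P : B → Set} (P? : Decidable P) (p r : List B) →
                       length p ≤ length (takeWhile P? (p ++ r)) → All P p
all-prefix-takeWhile P? []      r _ = []
all-prefix-takeWhile P? (y ∷ p) r h with P? y | h
... | yes py | s≤s h′ = py ∷ all-prefix-takeWhile P? p r h′
... | no  _  | ()

takeWhile-++-drop : ∀ {B : Set} {P : B → Set} (P? : Decidable P) (xs : List B) →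
                    xs ≡ takeWhile P? xs ++ drop (length (takeWhile P? xs)) xs
takeWhile-++-drop P? []       = refl
takeWhile-++-drop P? (x ∷ xs) with P? x
... | yes _ = cong (x ∷_) (takeWhile-++-drop P? xs)
... | no  _ = refl

length-takeWhile-++ : ∀ {B : Set} {P : B → Set} (P? : Decidable P) (xs ys : List B) →
                      length (takeWhile P? xs) ≤ length (takeWhile P? (xs ++ ys))
length-takeWhile-++ P? []       ys = z≤n
length-takeWhile-++ P? (x ∷ xs) ys with P? x
... | yes _ = s≤s (length-takeWhile-++ P? xs ys)
... | no  _ = z≤n

take-prefix : ∀ {B : Set} {v a b : List B} → v ≡ a ++ b → take (length v ∸ length b) v ≡ a
take-prefix {a = a} {b} refl
  rewrite length-++ a {b} | m+n∸n≡m (length a) (length b) = take-length a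
  where
  take-length : ∀ a → take (length a) (a ++ b) ≡ a
  take-length []      = refl
  take-length (x ∷ a) = cong (x ∷_) (take-length a)

module Runs {B : Set} (_≟_ : DecidableEquality B) where
  open Str _≟_

  boundary : B → B → ℕ
  boundary x y with x ≟ y
  ... | yes _ = 0
  ... | no  _ = 1

  runs : List B → ℕ
  runs []          = 0
  runs (x ∷ [])    = 1
  runs (x ∷ y ∷ l) = boundary x y + runs (y ∷ l)

  boundary-refl : ∀ x → boundary x x ≡ 0
  boundary-refl x with x ≟ x
  ... | yes _   = refl
  ... | no  x≢x = contradiction refl x≢x

  boundary-sym : ∀ x y → boundary x y ≡ boundary y x
  boundary-sym x y with x ≟ y | y ≟ x
  ... | yes _   | yes _   = refl
  ... | no  _   | no  _   = refl
  ... | yes x≡y | no  y≢x = contradiction (≡.sym x≡y) y≢x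
  ... | no  x≢y | yes y≡x = contradiction (≡.sym y≡x) x≢y

  boundary-≤1 : ∀ x y → boundary x y ≤ 1
  boundary-≤1 x y with x ≟ y
  ... | yes _ = z≤n
  ... | no  _ = ≤-refl

  rle-head : ∀ y l → ∃₂ λ m rest → rle (y ∷ l) ≡ (y , m) ∷ rest
  rle-head y l with rle l
  ... | [] = 1 , [] , refl
  ... | (a , m) ∷ rest with y ≟ a
  ...   | yes refl = suc m , rest , refl
  ...   | no  _    = 1 , (a , m) ∷ rest , refl

  numRuns-cons : ∀ x y l → numRuns (x ∷ y ∷ l) ≡ boundary x y + numRuns (y ∷ l)
  numRuns-cons x y l with rle (y ∷ l) | rle-head y l
  ... | _ | m , rest , refl with x ≟ y
  ...   | yes _ = refl
  ...   | no  _ = refl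

  numRuns≡runs : ∀ l → numRuns l ≡ runs l
  numRuns≡runs []          = refl
  numRuns≡runs (x ∷ [])    = refl
  numRuns≡runs (x ∷ y ∷ l) =
    trans (numRuns-cons x y l) (cong (boundary x y +_) (numRuns≡runs (y ∷ l)))

  runs-pos : ∀ x xs → 1 ≤ runs (x ∷ xs)
  runs-pos x []       = ≤-refl
  runs-pos x (y ∷ ys) = ≤-trans (runs-pos y ys) (m≤n+m (runs (y ∷ ys)) (boundary x y))

  runs-cons-≤ : ∀ x l → runs (x ∷ l) ≤ suc (runs l)
  runs-cons-≤ x []      = ≤-refl
  runs-cons-≤ x (y ∷ l) = +-monoˡ-≤ (runs (y ∷ l)) (boundary-≤1 x y)

  runs-++-≤ : ∀ u v → runs (u ++ v) ≤ runs u + runs v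
  runs-++-≤ []          v = ≤-refl
  runs-++-≤ (x ∷ [])    v = runs-cons-≤ x v
  runs-++-≤ (x ∷ y ∷ u) v =
    ≤-trans (+-monoʳ-≤ (boundary x y) (runs-++-≤ (y ∷ u) v))
            (≤-reflexive (≡.sym (+-assoc (boundary x y) (runs (y ∷ u)) (runs v))))

  runs-constant : ∀ {x} u → All (x ≡_) u → runs (x ∷ u) ≡ 1
  runs-constant []      []           = refl
  runs-constant (y ∷ u) (refl ∷ x≡u) = cong₂ _+_ (boundary-refl y) (runs-constant u x≡u)

  runs-snoc : ∀ l y z → runs (l ++ y ∷ z ∷ []) ≡ runs (l ++ [ y ]) + boundary y z
  runs-snoc []          y z = +-comm (boundary y z) 1
  runs-snoc (x ∷ [])    y z =
    trans (cong (boundary x y +_) (runs-snoc [] y z)) (≡.sym (+-assoc (boundary x y) 1 (boundary y z)))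
  runs-snoc (x ∷ w ∷ l) y z =
    trans (cong (boundary x w +_) (runs-snoc (w ∷ l) y z))
          (≡.sym (+-assoc (boundary x w) (runs (w ∷ l ++ [ y ])) (boundary y z)))

  runs-reverse : ∀ l → runs (reverse l) ≡ runs l
  runs-reverse []          = refl
  runs-reverse (x ∷ [])    = refl
  runs-reverse (x ∷ y ∷ l) = begin
    runs (reverse (x ∷ y ∷ l))                ≡⟨ cong runs reverse-xyl ⟩
    runs (reverse l ++ y ∷ x ∷ [])            ≡⟨ runs-snoc (reverse l) y x ⟩
    runs (reverse l ++ [ y ]) + boundary y x  ≡⟨ cong (λ k → runs k + boundary y x) (≡.sym (unfold-reverse y l)) ⟩
    runs (reverse (y ∷ l)) + boundary y x     ≡⟨ cong₂ _+_ (runs-reverse (y ∷ l)) (boundary-sym y x) ⟩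
    runs (y ∷ l) + boundary x y               ≡⟨ +-comm (runs (y ∷ l)) (boundary x y) ⟩
    boundary x y + runs (y ∷ l)               ∎
    where
    open ≡-Reasoning
    reverse-xyl : reverse (x ∷ y ∷ l) ≡ reverse l ++ y ∷ x ∷ []
    reverse-xyl = trans (unfold-reverse x (y ∷ l))
                        (trans (cong (_++ [ x ]) (unfold-reverse y l)) (++-assoc (reverse l) [ y ] [ x ]))

  leadRun-++-rest : ∀ l → l ≡ leadRun l ++ drop (leadLen l) l
  leadRun-++-rest []       = refl
  leadRun-++-rest (x ∷ xs) = cong (x ∷_) (takeWhile-++-drop (x ≟_) xs)

  runs-dropLead : ∀ l → 1 ≤ runs l → runs l ≡ suc (runs (drop (leadLen l) l))
  runs-dropLead (x ∷ xs) _ = go xs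
    where
    go : ∀ xs → runs (x ∷ xs) ≡ suc (runs (drop (length (takeWhile (x ≟_) xs)) xs))
    go []       = refl
    go (y ∷ ys) with x ≟ y
    ... | yes refl = go ys
    ... | no  _    = refl

  leadLen-++ : ∀ u v → 2 ≤ runs u → leadLen (u ++ v) ≡ leadLen u
  leadLen-++ (x ∷ xs) v = cong suc ∘ go xs
    where
    go : ∀ xs → 2 ≤ runs (x ∷ xs) →
         length (takeWhile (x ≟_) (xs ++ v)) ≡ length (takeWhile (x ≟_) xs)
    go []       (s≤s ())
    go (y ∷ ys) 2≤runs with x ≟ y
    ... | yes refl = cong suc (go ys 2≤runs)
    ... | no  _    = refl

  leadLen-++-≥ : ∀ u v → leadLen u ≤ leadLen (u ++ v)
  leadLen-++-≥ []       v = z≤n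
  leadLen-++-≥ (x ∷ xs) v = s≤s (length-takeWhile-++ (x ≟_) xs v)

  leadLen-oneRun : ∀ u → runs u ≡ 1 → leadLen u ≡ length u
  leadLen-oneRun (x ∷ xs) = cong suc ∘ go xs
    where
    go : ∀ xs → runs (x ∷ xs) ≡ 1 → length (takeWhile (x ≟_) xs) ≡ length xs
    go []       _ = refl
    go (y ∷ ys) runs≡1 with x ≟ y
    ... | yes refl = cong suc (go ys runs≡1)
    ... | no  _    = contradiction runs≡1 (>⇒≢ (s≤s (runs-pos y ys)))

  trailLen-++ : ∀ u v → trailLen (u ++ v) ≡ leadLen (reverse v ++ reverse u)
  trailLen-++ u v = trans (length-reverse (leadRun (reverse (u ++ v)))) (cong leadLen (reverse-++ u v))

  runs-dropTrail : ∀ v → 1 ≤ runs v → runs v ≡ suc (runs (take (length v ∸ trailLen v) v))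
  runs-dropTrail v 1≤runs = begin
    runs v                                       ≡⟨ ≡.sym (runs-reverse v) ⟩
    runs w                                       ≡⟨ runs-dropLead w 1≤runs-w ⟩
    suc (runs rest)                              ≡⟨ cong suc (≡.sym (runs-reverse rest)) ⟩
    suc (runs (reverse rest))                    ≡⟨ cong (suc ∘ runs) (≡.sym (take-prefix {a = reverse rest} v≡)) ⟩
    suc (runs (take (length v ∸ trailLen v) v))  ∎
    where
    open ≡-Reasoning
    w rest : List B
    w    = reverse v
    rest = drop (leadLen w) w
    1≤runs-w : 1 ≤ runs w
    1≤runs-w = ≤-trans 1≤runs (≤-reflexive (≡.sym (runs-reverse v)))
    v≡ : v ≡ reverse rest ++ reverse (leadRun w)
    v≡ = begin
      v                                     ≡⟨ ≡.sym (reverse-involutive v) ⟩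
      reverse w                             ≡⟨ cong reverse (leadRun-++-rest w) ⟩
      reverse (leadRun w ++ rest)           ≡⟨ reverse-++ (leadRun w) rest ⟩
      reverse rest ++ reverse (leadRun w)   ∎

  -- If v is a single run, the trailing run of u ++ v may reach into u; the truncated
  -- subtraction then leaves nothing of v.
  runs-peelTrail : ∀ u v → 1 ≤ runs v → runs v ≡ suc (runs (take (length v ∸ trailLen (u ++ v)) v))
  runs-peelTrail u v 1≤runs with m≤n⇒m<n∨m≡n 1≤runs
  ... | inj₁ 2≤runs =
    trans (runs-dropTrail v 1≤runs) (cong (λ k → suc (runs (take (length v ∸ k) v))) (≡.sym trailLen≡))
    where
    2≤runs-w : 2 ≤ runs (reverse v)
    2≤runs-w = ≤-trans 2≤runs (≤-reflexive (≡.sym (runs-reverse v)))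
    trailLen≡ : trailLen (u ++ v) ≡ trailLen v
    trailLen≡ = trans (trailLen-++ u v)
                      (trans (leadLen-++ (reverse v) (reverse u) 2≤runs-w)
                             (≡.sym (length-reverse (leadRun (reverse v)))))
  ... | inj₂ 1≡runs =
    trans (≡.sym 1≡runs) (cong (λ k → suc (runs (take k v))) (≡.sym (m≤n⇒m∸n≡0 v≤trailLen)))
    where
    open ≤-Reasoning
    runs-w≡1 : runs (reverse v) ≡ 1
    runs-w≡1 = trans (runs-reverse v) (≡.sym 1≡runs)
    v≤trailLen : length v ≤ trailLen (u ++ v)
    v≤trailLen = begin
      length v                          ≡⟨ ≡.sym (length-reverse v) ⟩
      length (reverse v)                ≡⟨ ≡.sym (leadLen-oneRun (reverse v) runs-w≡1) ⟩
      leadLen (reverse v)               ≤⟨ leadLen-++-≥ (reverse v) (reverse u) ⟩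
      leadLen (reverse v ++ reverse u)  ≡⟨ ≡.sym (trailLen-++ u v) ⟩
      trailLen (u ++ v)                 ∎

  runs-peelFull : ∀ sp {r rs mid} → drop (leadLen sp) sp ≡ r ∷ rs →
                  take (length (r ∷ rs) ∸ trailLen sp) (r ∷ rs) ≡ mid → runs sp ≡ 2 + runs mid
  runs-peelFull (x ∷ xs) {r} {rs} {mid} rest≡ mid≡ = begin
    runs (x ∷ xs)                                  ≡⟨ runs-dropLead (x ∷ xs) (runs-pos x xs) ⟩
    suc (runs (drop (leadLen (x ∷ xs)) (x ∷ xs)))  ≡⟨ cong (suc ∘ runs) rest≡ ⟩
    suc (runs (r ∷ rs))                            ≡⟨ cong suc (runs-peelTrail lead (r ∷ rs) (runs-pos r rs)) ⟩
    2 + runs (peelTrailOf (lead ++ r ∷ rs))        ≡⟨ cong (λ sp → 2 + runs (peelTrailOf sp)) (≡.sym sp≡) ⟩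
    2 + runs (peelTrailOf (x ∷ xs))                ≡⟨ cong (λ m → 2 + runs m) mid≡ ⟩
    2 + runs mid                                   ∎
    where
    open ≡-Reasoning
    lead : List B
    lead = leadRun (x ∷ xs)
    peelTrailOf : List B → List B
    peelTrailOf sp = take (length (r ∷ rs) ∸ trailLen sp) (r ∷ rs)
    sp≡ : x ∷ xs ≡ lead ++ r ∷ rs
    sp≡ = trans (leadRun-++-rest (x ∷ xs)) (cong (lead ++_) rest≡)

  runs-leadPrefix : ∀ p r → length p ≤ leadLen (p ++ r) → runs p ≤ 1
  runs-leadPrefix []      r _       = z≤n
  runs-leadPrefix (x ∷ p) r (s≤s h) = ≤-reflexive (runs-constant p (all-prefix-takeWhile (x ≟_) p r h))

  runs-trailSuffix : ∀ u q → length q ≤ trailLen (u ++ q) → runs q ≤ 1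
  runs-trailSuffix u q h = subst (_≤ 1) (runs-reverse q) (runs-leadPrefix (reverse q) (reverse u) h′)
    where
    h′ : length (reverse q) ≤ leadLen (reverse q ++ reverse u)
    h′ = subst₂ _≤_ (≡.sym (length-reverse q)) (trailLen-++ u q) h

  runs-peel-≤ : ∀ p m q → length p ≤ leadLen (p ++ m ++ q) → length q ≤ trailLen (p ++ m ++ q) →
                runs (p ++ m ++ q) ≤ 2 + runs m
  runs-peel-≤ p m q p≤lead q≤trail = begin
    runs (p ++ m ++ q)      ≤⟨ runs-++-≤ p (m ++ q) ⟩
    runs p + runs (m ++ q)  ≤⟨ +-mono-≤ (runs-leadPrefix p (m ++ q) p≤lead) (runs-++-≤ m q) ⟩
    1 + (runs m + runs q)   ≤⟨ +-monoʳ-≤ 1 (+-monoʳ-≤ (runs m) (runs-trailSuffix (p ++ m) q q≤trail′)) ⟩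
    1 + (runs m + 1)        ≡⟨ cong suc (+-comm (runs m) 1) ⟩
    2 + runs m              ∎
    where
    open ≤-Reasoning
    q≤trail′ : length q ≤ trailLen ((p ++ m) ++ q)
    q≤trail′ = subst (λ s → length q ≤ trailLen s) (≡.sym (++-assoc p m q)) q≤trail

runs-map : ∀ {A B : Set} (_≟ᴬ_ : DecidableEquality A) (_≟ᴮ_ : DecidableEquality B) {f : A → B} →
           Injective _≡_ _≡_ f → ∀ s → Runs.runs _≟ᴮ_ (map f s) ≡ Runs.runs _≟ᴬ_ s
runs-map _≟ᴬ_ _≟ᴮ_ {f} f-inj = go
  where
  boundary-map : ∀ x y → Runs.boundary _≟ᴮ_ (f x) (f y) ≡ Runs.boundary _≟ᴬ_ x y
  boundary-map x y with f x ≟ᴮ f y | x ≟ᴬ y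
  ... | yes _     | yes _   = refl
  ... | no  _     | no  _   = refl
  ... | yes fx≡fy | no  x≢y = contradiction (f-inj fx≡fy) x≢y
  ... | no  fx≢fy | yes x≡y = contradiction (cong f x≡y) fx≢fy
  go : ∀ s → Runs.runs _≟ᴮ_ (map f s) ≡ Runs.runs _≟ᴬ_ s
  go []          = refl
  go (x ∷ [])    = refl
  go (x ∷ y ∷ s) = cong₂ _+_ (boundary-map x y) (go (y ∷ s))

module _ {A : Set} (_≟_ : DecidableEquality A) where
  open Runs _≟_
  open Decomposition _≟_

  tokens-lowerBound : ∀ {s} (d : Decomp s) → ⌈ runs s /2⌉ ≤ tokens d
  tokens-lowerBound (term s _ numRuns≤2) = ⌈n/2⌉-mono (subst (_≤ 2) (numRuns≡runs s) numRuns≤2)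
  tokens-lowerBound (peel _ p m q _ refl _ p≤lead _ q≤trail d) =
    ≤-trans (⌈n/2⌉-mono (runs-peel-≤ p m q p≤lead q≤trail)) (s≤s (tokens-lowerBound d))

module _ {A : Set} (_≟_ : DecidableEquality A) where
  open Flashback _≟_
  open Str _≟ₑ_
  open Runs _≟ₑ_

  length-flash : ∀ n sp → length sp ≤ n → length (flash n sp) ≡ ⌈ runs sp /2⌉
  length-flash zero    []       _ = refl
  length-flash (suc n) []       _ = refl
  length-flash (suc n) (x ∷ xs) (s≤s xs≤n) with drop (leadLen (x ∷ xs)) (x ∷ xs) in rest≡
  ... | [] =
    cong ⌈_/2⌉ (≡.sym (trans (runs-dropLead (x ∷ xs) (runs-pos x xs)) (cong (suc ∘ runs) rest≡)))
  ... | r ∷ rs with take (length (r ∷ rs) ∸ trailLen (x ∷ xs)) (r ∷ rs) in mid≡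
  ...   | []     = cong ⌈_/2⌉ (≡.sym (runs-peelFull (x ∷ xs) rest≡ mid≡))
  ...   | m ∷ ms = trans (cong suc (length-flash n (m ∷ ms) mid≤n))
                         (cong ⌈_/2⌉ (≡.sym (runs-peelFull (x ∷ xs) rest≡ mid≡)))
    where
    open ≤-Reasoning
    peeled lead : ℕ
    peeled = length (r ∷ rs) ∸ trailLen (x ∷ xs)
    lead   = length (takeWhile (x ≟ₑ_) xs)
    mid≤n : length (m ∷ ms) ≤ n
    mid≤n = begin
      length (m ∷ ms)                ≡⟨ cong length (≡.sym mid≡) ⟩
      length (take peeled (r ∷ rs))  ≡⟨ length-take peeled (r ∷ rs) ⟩
      peeled ⊓ length (r ∷ rs)       ≤⟨ m⊓n≤n peeled (length (r ∷ rs)) ⟩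
      length (r ∷ rs)                ≡⟨ cong length (≡.sym rest≡) ⟩
      length (drop lead xs)          ≡⟨ length-drop lead xs ⟩
      length xs ∸ lead               ≤⟨ m∸n≤m (length xs) lead ⟩
      length xs                      ≤⟨ xs≤n ⟩
      n                              ∎

  token≢τ₀ : ∀ {x l k} → x ≢ at → (x ∷ l , k) ≢ τ₀
  token≢τ₀ x≢at refl = x≢at refl

  flash-avoids-τ₀ : ∀ n sp → All (_≢ at) sp → All (_≢ τ₀) (flash n sp)
  flash-avoids-τ₀ zero    sp       _ = []
  flash-avoids-τ₀ (suc n) []       _ = []
  flash-avoids-τ₀ (suc n) (x ∷ xs) sp≢at@(x≢at ∷ _) with drop (leadLen (x ∷ xs)) (x ∷ xs) in rest≡
  ... | [] = token≢τ₀ x≢at ∷ []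
  ... | r ∷ rs with take (length (r ∷ rs) ∸ trailLen (x ∷ xs)) (r ∷ rs) in mid≡
  ...   | []     = token≢τ₀ x≢at ∷ []
  ...   | m ∷ ms = token≢τ₀ x≢at ∷ flash-avoids-τ₀ n (m ∷ ms) mid≢at
    where
    rest≢at : All (_≢ at) (r ∷ rs)
    rest≢at = subst (All (_≢ at)) rest≡ (drop⁺ (leadLen (x ∷ xs)) sp≢at)
    mid≢at : All (_≢ at) (m ∷ ms)
    mid≢at = subst (All (_≢ at)) mid≡ (take⁺ (length (r ∷ rs) ∸ trailLen (x ∷ xs)) rest≢at)

  trailRun-hat : ∀ s → trailRun (hat s) ≡ dollar ∷ []
  trailRun-hat s = trans (cong (reverse ∘ leadRun) reverse-hat) (dollar-alone (reverse s))
    where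
    open ≡-Reasoning
    reverse-hat : reverse (hat s) ≡ dollar ∷ map sym (reverse s) ++ at ∷ []
    reverse-hat = begin
      reverse (hat s)                          ≡⟨ reverse-++ (at ∷ map sym s) (dollar ∷ []) ⟩
      dollar ∷ reverse (at ∷ map sym s)        ≡⟨ cong (dollar ∷_) (unfold-reverse at (map sym s)) ⟩
      dollar ∷ reverse (map sym s) ++ at ∷ []  ≡⟨ cong (λ l → dollar ∷ l ++ at ∷ []) (≡.sym (reverse-map sym s)) ⟩
      dollar ∷ map sym (reverse s) ++ at ∷ []  ∎
    dollar-alone : ∀ t → reverse (leadRun (dollar ∷ map sym t ++ at ∷ [])) ≡ dollar ∷ []
    dollar-alone []      = refl
    dollar-alone (_ ∷ _) = refl

  mid-hat : ∀ s → let body = map sym s ++ dollar ∷ [] in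
            take (length body ∸ trailLen (hat s)) body ≡ map sym s
  mid-hat s = trans (cong (λ k → take (length body ∸ k) body) (cong length (trailRun-hat s)))
                    (take-prefix refl)
    where
    body : List (Ext A)
    body = map sym s ++ dollar ∷ []

  𝓕-unfold : ∀ y ys →
             𝓕 (y ∷ ys) ≡ τ₀ ∷ flash (length (map sym (y ∷ ys) ++ dollar ∷ [])) (map sym (y ∷ ys))
  𝓕-unfold y ys rewrite mid-hat (y ∷ ys) | trailRun-hat (y ∷ ys) = refl

  flashback-count : ∀ s → s ≢ [] →
                    length (filter (λ t → ¬? (t ≟τ τ₀)) (𝓕 s)) ≡ ⌈ Runs.runs _≟_ s /2⌉
  flashback-count []         s≢[] = contradiction refl s≢[]
  flashback-count s@(y ∷ ys) _    = begin
    length (filter notτ₀? (𝓕 s))                  ≡⟨ cong (length ∘ filter notτ₀?) (𝓕-unfold y ys) ⟩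
    length (filter notτ₀? (τ₀ ∷ flash n syms))    ≡⟨ cong length (filter-reject notτ₀? {xs = flash n syms} (λ ne → ne refl)) ⟩
    length (filter notτ₀? (flash n syms))         ≡⟨ cong length (filter-all notτ₀? (flash-avoids-τ₀ n syms syms≢at)) ⟩
    length (flash n syms)                         ≡⟨ length-flash n syms (length-++-≤ˡ syms) ⟩
    ⌈ runs syms /2⌉                               ≡⟨ cong ⌈_/2⌉ (runs-map _≟_ _≟ₑ_ (λ { refl → refl }) s) ⟩
    ⌈ Runs.runs _≟_ s /2⌉                         ∎
    where
    open ≡-Reasoning
    notτ₀? : (t : Token) → Dec (t ≢ τ₀)
    notτ₀? t = ¬? (t ≟τ τ₀)
    syms : List (Ext A)
    syms = map sym s
    n : ℕ
    n = length (syms ++ dollar ∷ [])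
    syms≢at : All (_≢ at) syms
    syms≢at = map⁺ (universal (λ _ ()) s)

mainTheorem9 : {A : Set} (_≟_ : DecidableEquality A) (s : List A) → s ≢ [] →
    ((d : Decomposition.Decomp _≟_ s) →
       ⌈ Str.numRuns _≟_ s /2⌉ ≤ Decomposition.tokens _≟_ d)
    × (length (filter (λ t → ¬? (Flashback._≟τ_ _≟_ t (Flashback.τ₀ _≟_))) (Flashback.𝓕 _≟_ s))
       ≡ ⌈ Str.numRuns _≟_ s /2⌉)
mainTheorem9 _≟_ s s≢[] rewrite Runs.numRuns≡runs _≟_ s =
  tokens-lowerBound _≟_ , flashback-count _≟_ s s≢[]
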